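{- Let $t>2$ be a natural number, $n=2t+1$, and let $W=2^t+2+1$ be the Welch exponent, with $W^{ -1}$ its inverse modulo $2^n-1$. Then $W^{ -1}\pmod{2^n-1}$ is never congruent to $e(l,k)$ modulo $2^n-1$ for any natural number $l<n$ and any natural number $k$.
   Context: For natural numbers $l,k$, $e(l,k)=\sum_{j=0}^{l-1}2^{jk}$. -}

module Defs where

open import Data.Nat using (ℕ; zero; suc; _+_; _*_; _∸_; _^_)
open import Data.Integer using (ℤ; +_; _-_)
open import Data.Integer.Divisibility using (_∣_)

e : ℕ → ℕ → ℕ
e zero    k = 0
e (suc l) k = e l k + 2 ^ (l * k)

infix 4 _≡_[mod_]
_≡_[mod_] : ℕ → ℕ → ℕ → Set
a ≡ b [mod m ] = (+ m) ∣ ((+ a) - (+ b))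

welch : ℕ → ℕ
welch t = 2 ^ t + 2 + 1

module Submission where

-- Let M = 2^n − 1, so that 2^n ≡ 1 (mod M). If W·e(l,k) ≡ 1, multiplying the geometric
-- identity e(l,k)·2^k + 1 = e(l,k) + 2^{lk} by W gives W·2^a + 1 ≡ W + 2^b, where
-- a = lk mod n and b = k mod n. If b = 0 then e(l,k) ≡ l, and W·l ≡ 1 is impossible because
-- 1 < W and W·l < M. Otherwise a ≠ 0, and the congruence becomes
-- 2^{t+a} + 2^{a+1} + 2^a ≡ 2^t + 2 + 2^b. A residue in [1, M] has a unique binary expansion,
-- and both sides reduce to three distinct powers of two below 2^n (the right side to only two
-- when b ∈ {1, t}): on the right, t is one of the two top exponents and the lowest exponent is
-- at most 1, while on the left, after reducing t + a and a + 1 modulo n, this never happens.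

open import Defs
open import Data.Nat
  using (ℕ; zero; suc; _+_; _*_; _∸_; _^_; _<_; _≤_; z≤n; s≤s; s≤s⁻¹; z<s; s<s; s<s⁻¹;
         NonZero; >-nonZero; >-nonZero⁻¹)
open import Data.Nat.Properties
open import Data.Nat.Divisibility as ℕ∣ using (_∣0; >⇒∤)
open import Data.Nat.DivMod using (_%_; _/_; m≡m%n+[m/n]*n; m%n<n)
open import Data.Nat.Tactic.RingSolver using (solve-∀)
open import Data.Product using (_×_; _,_; proj₁; Σ-syntax)
open import Data.Sum as Sum using (_⊎_; inj₁; inj₂)
open import Relation.Binary.Bundles using (Setoid)
open import Relation.Binary.Structures using (IsEquivalence)
open import Relation.Binary.PropositionalEquality
open import Relation.Binary.Definitions using (tri<; tri≈; tri>)
open import Data.Empty using (⊥)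
open import Relation.Nullary using (¬_; contradiction)
open import Algebra.Properties.CommutativeSemigroup +-commutativeSemigroup
  using (x∙yz≈y∙xz; x∙yz≈y∙zx; x∙yz≈z∙xy; xy∙z≈x∙zy; xy∙z≈xz∙y; xy∙z≈z∙xy)

e*2^k+1≡e+2^[l*k] : ∀ l k → e l k * 2 ^ k + 1 ≡ e l k + 2 ^ (l * k)
e*2^k+1≡e+2^[l*k] zero k = refl
e*2^k+1≡e+2^[l*k] (suc l) k = begin
  (e l k + 2 ^ (l * k)) * 2 ^ k + 1          ≡⟨ distribute (e l k) (2 ^ (l * k)) (2 ^ k) ⟩
  (e l k * 2 ^ k + 1) + 2 ^ k * 2 ^ (l * k)  ≡⟨ cong₂ _+_ (e*2^k+1≡e+2^[l*k] l k) (sym (^-distribˡ-+-* 2 k (l * k))) ⟩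
  e l k + 2 ^ (l * k) + 2 ^ (k + l * k)      ∎
  where
  open ≡-Reasoning
  distribute : ∀ x y z → (x + y) * z + 1 ≡ (x * z + 1) + z * y
  distribute = solve-∀

n+n≤2^n : ∀ n → n + n ≤ 2 ^ n
n+n≤2^n zero          = z≤n
n+n≤2^n (suc zero)    = ≤-refl
n+n≤2^n (suc (suc n)) = begin
  suc (suc n) + suc (suc n)  ≡⟨ cong suc (+-suc (suc n) (suc n)) ⟩
  2 + (suc n + suc n)        ≤⟨ +-mono-≤ (^-monoʳ-≤ 2 {1} {suc n} (s≤s z≤n)) (n+n≤2^n (suc n)) ⟩
  2 ^ suc n + 2 ^ suc n      ≡⟨ cong (2 ^ suc n +_) (+-identityʳ (2 ^ suc n)) ⟨
  2 ^ suc (suc n)            ∎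
  where open ≤-Reasoning

2^-monoʳ-< : ∀ {p q} → p < q → 2 ^ p < 2 ^ q
2^-monoʳ-< = ^-monoʳ-< 2 (s≤s (s≤s z≤n))

2^p+x<2^q : ∀ {p q x} → x < 2 ^ p → p < q → 2 ^ p + x < 2 ^ q
2^p+x<2^q {p} {q} {x} x<2^p p<q = begin-strict
  2 ^ p + x          <⟨ +-monoʳ-< (2 ^ p) x<2^p ⟩
  2 ^ p + 2 ^ p      ≡⟨ cong (2 ^ p +_) (+-identityʳ (2 ^ p)) ⟨
  2 ^ suc p          ≤⟨ ^-monoʳ-≤ 2 p<q ⟩
  2 ^ q              ∎
  where open ≤-Reasoning

0<2^p+x : ∀ p x → 0 < 2 ^ p + x
0<2^p+x p x = <-≤-trans (m^n>0 2 p) (m≤m+n (2 ^ p) x)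

2^p+x-injective : ∀ {p q x y} → x < 2 ^ p → y < 2 ^ q → 2 ^ p + x ≡ 2 ^ q + y → p ≡ q × x ≡ y
2^p+x-injective {p} {q} {x} {y} x<2^p y<2^q eq with <-cmp p q
... | tri< p<q _ _ = contradiction eq (<⇒≢ (<-≤-trans (2^p+x<2^q x<2^p p<q) (m≤m+n (2 ^ q) y)))
... | tri≈ _ refl _ = refl , +-cancelˡ-≡ (2 ^ p) x y eq
... | tri> _ _ q<p = contradiction (sym eq) (<⇒≢ (<-≤-trans (2^p+x<2^q y<2^q q<p) (m≤m+n (2 ^ p) x)))

bits₂ : ℕ → ℕ → ℕ
bits₂ q r = 2 ^ q + 2 ^ r

bits₃ : ℕ → ℕ → ℕ → ℕ
bits₃ p q r = 2 ^ p + bits₂ q r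

bits₂<2^ : ∀ {p q r} → r < q → q < p → bits₂ q r < 2 ^ p
bits₂<2^ r<q q<p = 2^p+x<2^q (2^-monoʳ-< r<q) q<p

bits₃-injective : ∀ {p q r p′ q′ r′} → r < q → q < p → r′ < q′ → q′ < p′ →
                  bits₃ p q r ≡ bits₃ p′ q′ r′ → p ≡ p′ × q ≡ q′ × r ≡ r′
bits₃-injective {p} {q} {r} {p′} {q′} {r′} r<q q<p r′<q′ q′<p′ eq
  with refl , eq′ ← 2^p+x-injective {p} {p′} (bits₂<2^ r<q q<p) (bits₂<2^ r′<q′ q′<p′) eq
  with refl , eq″ ← 2^p+x-injective {q} {q′} (2^-monoʳ-< r<q) (2^-monoʳ-< r′<q′) eq′
  = refl , refl , proj₁ (2^p+x-injective (m^n>0 2 r) (m^n>0 2 r′) (cong (_+ 0) eq″))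

bits₃≢bits₂ : ∀ {p q r p′ q′} → r < q → q < p → q′ < p′ → bits₃ p q r ≢ bits₂ p′ q′
bits₃≢bits₂ {p} {q} {r} {p′} {q′} r<q q<p q′<p′ eq
  with refl , eq′ ← 2^p+x-injective {p} {p′} (bits₂<2^ r<q q<p) (2^-monoʳ-< q′<p′) eq
  with refl , 2^r≡0 ← 2^p+x-injective {q} {q′} (2^-monoʳ-< r<q) (m^n>0 2 q′) (trans eq′ (sym (+-identityʳ _)))
  = <⇒≢ (m^n>0 2 r) (sym 2^r≡0)

welch*2^a≡bits₃ : ∀ t a → welch t * 2 ^ a ≡ bits₃ (t + a) (suc a) a
welch*2^a≡bits₃ t a = begin
  (2 ^ t + 2 + 1) * 2 ^ a              ≡⟨ distribute (2 ^ t) (2 ^ a) ⟩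
  2 ^ t * 2 ^ a + (2 * 2 ^ a + 2 ^ a)  ≡⟨ cong (_+ (2 * 2 ^ a + 2 ^ a)) (^-distribˡ-+-* 2 t a) ⟨
  bits₃ (t + a) (suc a) a              ∎
  where
  open ≡-Reasoning
  distribute : ∀ x y → (x + 2 + 1) * y ≡ x * y + (2 * y + y)
  distribute = solve-∀

module ModularArithmetic (m : ℕ) where

  open import Data.Integer as ℤ using (+_)
  open import Data.Integer.Properties as ℤ
    using (pos-+; pos-*; [+m]-[+n]≡m⊖n; ∣m⊝n∣≤m⊔n; ∣i∣≡0⇒i≡0; i-j≡0⇒i≡j)
  open import Data.Integer.Divisibility.Signed as ℤ∣
    using (∣ᵤ⇒∣; ∣⇒∣ᵤ; ∣-refl; ∣m∣n⇒∣m+n; ∣m⇒∣-m; ∣m⇒∣m*n; ∣n⇒∣m*n)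
  import Data.Integer.Tactic.RingSolver as ℤ

  -- A record rather than a synonym, so that both sides can be recovered by unification.
  infix 4 _≈_
  record _≈_ (a b : ℕ) : Set where
    constructor mk≈
    field ≡-mod : a ≡ b [mod m ]
  open _≈_ public

  private
    ∣-diff : ∀ {a b} → a ≈ b → + m ℤ∣.∣ (+ a ℤ.- + b)
    ∣-diff p = ∣ᵤ⇒∣ (≡-mod p)

    ≈-by : ∀ {a b x} → + a ℤ.- + b ≡ x → + m ℤ∣.∣ x → a ≈ b
    ≈-by eq m∣x = mk≈ (∣⇒∣ᵤ (subst (+ m ℤ∣.∣_) (sym eq) m∣x))

  ≈-reflexive : ∀ {a b} → a ≡ b → a ≈ b
  ≈-reflexive {a} refl = ≈-by (ℤ.+-inverseʳ (+ a)) (∣ᵤ⇒∣ (m ∣0))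

  ≈-sym : ∀ {a b} → a ≈ b → b ≈ a
  ≈-sym {a} {b} p = ≈-by (identity (+ a) (+ b)) (∣m⇒∣-m (∣-diff p))
    where identity : ∀ x y → y ℤ.- x ≡ ℤ.- (x ℤ.- y)
          identity = ℤ.solve-∀

  ≈-trans : ∀ {a b c} → a ≈ b → b ≈ c → a ≈ c
  ≈-trans {a} {b} {c} p q = ≈-by (identity (+ a) (+ b) (+ c)) (∣m∣n⇒∣m+n (∣-diff p) (∣-diff q))
    where identity : ∀ x y z → x ℤ.- z ≡ (x ℤ.- y) ℤ.+ (y ℤ.- z)
          identity = ℤ.solve-∀

  ≈-isEquivalence : IsEquivalence _≈_
  ≈-isEquivalence = record { refl = ≈-reflexive refl ; sym = ≈-sym ; trans = ≈-trans }

  ≈-setoid : Setoid _ _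
  ≈-setoid = record { isEquivalence = ≈-isEquivalence }

  m≈0 : m ≈ 0
  m≈0 = ≈-by (ℤ.+-identityʳ (+ m)) ∣-refl

  +-cong : ∀ {a b c d} → a ≈ b → c ≈ d → a + c ≈ b + d
  +-cong {a} {b} {c} {d} p q = ≈-by
    (trans (cong₂ ℤ._-_ (pos-+ a c) (pos-+ b d)) (identity (+ a) (+ b) (+ c) (+ d)))
    (∣m∣n⇒∣m+n (∣-diff p) (∣-diff q))
    where identity : ∀ x y z w → (x ℤ.+ z) ℤ.- (y ℤ.+ w) ≡ (x ℤ.- y) ℤ.+ (z ℤ.- w)
          identity = ℤ.solve-∀

  *-cong : ∀ {a b c d} → a ≈ b → c ≈ d → a * c ≈ b * d
  *-cong {a} {b} {c} {d} p q = ≈-by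
    (trans (cong₂ ℤ._-_ (pos-* a c) (pos-* b d)) (identity (+ a) (+ b) (+ c) (+ d)))
    (∣m∣n⇒∣m+n (∣m⇒∣m*n (+ c) (∣-diff p)) (∣n⇒∣m*n (+ b) (∣-diff q)))
    where identity : ∀ x y z w → (x ℤ.* z) ℤ.- (y ℤ.* w) ≡ (x ℤ.- y) ℤ.* z ℤ.+ y ℤ.* (z ℤ.- w)
          identity = ℤ.solve-∀

  +-congˡ : ∀ c {a b} → a ≈ b → c + a ≈ c + b
  +-congˡ c = +-cong (≈-reflexive {c} refl)

  +-congʳ : ∀ c {a b} → a ≈ b → a + c ≈ b + c
  +-congʳ c p = +-cong p (≈-reflexive {c} refl)

  *-congʳ : ∀ c {a b} → a ≈ b → a * c ≈ b * c
  *-congʳ c p = *-cong p (≈-reflexive {c} refl)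

  *-congˡ : ∀ c {a b} → a ≈ b → c * a ≈ c * b
  *-congˡ c = *-cong (≈-reflexive {c} refl)

  +-cancelˡ : ∀ c {a b} → c + a ≈ c + b → a ≈ b
  +-cancelˡ c {a} {b} p = ≈-by
    (sym (trans (cong₂ ℤ._-_ (pos-+ c a) (pos-+ c b)) (identity (+ c) (+ a) (+ b))))
    (∣-diff p)
    where identity : ∀ z x y → (z ℤ.+ x) ℤ.- (z ℤ.+ y) ≡ x ℤ.- y
          identity = ℤ.solve-∀

  ≈⇒≡ : ∀ {a b} → a < m → b < m → a ≈ b → a ≡ b
  ≈⇒≡ {a} {b} a<m b<m p =
    ℤ.+-injective (i-j≡0⇒i≡j (+ a) (+ b) (∣i∣≡0⇒i≡0 (divisor-below (≡-mod p) ∣a-b∣<m)))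
    where
      divisor-below : ∀ {d} → m ℕ∣.∣ d → d < m → d ≡ 0
      divisor-below {zero}  _   _   = refl
      divisor-below {suc d} m∣d d<m = contradiction m∣d (>⇒∤ d<m)
      ∣a-b∣<m : ℤ.∣ + a ℤ.- + b ∣ < m
      ∣a-b∣<m = ≤-<-trans (≤-reflexive (cong ℤ.∣_∣ ([+m]-[+n]≡m⊖n a b)))
                 (≤-<-trans (∣m⊝n∣≤m⊔n a b) (⊔-lub a<m b<m))

  ≈⇒≡-pos : ∀ {a b} → 0 < a → a ≤ m → 0 < b → b ≤ m → a ≈ b → a ≡ b
  ≈⇒≡-pos {suc a} {suc b} _ a≤m _ b≤m p = cong suc (≈⇒≡ a≤m b≤m (+-cancelˡ 1 p))

  open import Relation.Binary.Reasoning.Setoid ≈-setoid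

  e≈length : ∀ {k} → 2 ^ k ≈ 1 → ∀ l → e l k ≈ l
  e≈length 2^k≈1 zero = ≈-reflexive refl
  e≈length {k} 2^k≈1 (suc l) = begin
    e l k + 2 ^ (l * k) ≈⟨ +-cong (e≈length 2^k≈1 l) (powers l) ⟩
    l + 1               ≡⟨ +-comm l 1 ⟩
    suc l               ∎
    where
      powers : ∀ j → 2 ^ (j * k) ≈ 1
      powers zero = ≈-reflexive refl
      powers (suc j) = begin
        2 ^ (k + j * k)      ≡⟨ ^-distribˡ-+-* 2 k (j * k) ⟩
        2 ^ k * 2 ^ (j * k)  ≈⟨ *-cong 2^k≈1 (powers j) ⟩
        1                    ∎

  w*e≈1⇒w*2^[l*k]+1≈w+2^k : ∀ w l k → w * e l k ≈ 1 → w * 2 ^ (l * k) + 1 ≈ w + 2 ^ k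
  w*e≈1⇒w*2^[l*k]+1≈w+2^k w l k we≈1 = begin
    w * P + 1            ≈⟨ +-congˡ (w * P) (≈-sym we≈1) ⟩
    w * P + w * E        ≡⟨ *-distribˡ-+ w P E ⟨
    w * (P + E)          ≡⟨ cong (w *_) (+-comm P E) ⟩
    w * (E + P)          ≡⟨ cong (w *_) (e*2^k+1≡e+2^[l*k] l k) ⟨
    w * (E * K + 1)      ≡⟨ distribute w E K ⟩
    w * E * K + w        ≈⟨ +-congʳ w (*-congʳ K we≈1) ⟩
    1 * K + w            ≡⟨ trans (cong (_+ w) (*-identityˡ K)) (+-comm K w) ⟩
    w + K                ∎
    where
      E = e l k
      P = 2 ^ (l * k)
      K = 2 ^ k
      distribute : ∀ w x y → w * (x * y + 1) ≡ w * x * y + w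
      distribute = solve-∀

module PowersOfTwo (n : ℕ) .{{_ : NonZero n}} where

  M : ℕ
  M = 2 ^ n ∸ 1

  open ModularArithmetic M public
  open import Relation.Binary.Reasoning.Setoid ≈-setoid

  2^n≡1+M : 2 ^ n ≡ suc M
  2^n≡1+M = sym (m+[n∸m]≡n (m^n>0 2 n))

  2^n≈1 : 2 ^ n ≈ 1
  2^n≈1 = begin
    2 ^ n  ≡⟨ 2^n≡1+M ⟩
    1 + M  ≈⟨ +-congˡ 1 m≈0 ⟩
    1      ∎

  2^[n+x]≈2^x : ∀ x → 2 ^ (n + x) ≈ 2 ^ x
  2^[n+x]≈2^x x = begin
    2 ^ (n + x)    ≡⟨ ^-distribˡ-+-* 2 n x ⟩
    2 ^ n * 2 ^ x  ≈⟨ *-congʳ (2 ^ x) 2^n≈1 ⟩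
    1 * 2 ^ x      ≡⟨ *-identityˡ (2 ^ x) ⟩
    2 ^ x          ∎

  2^x≈2^[x%n] : ∀ x → 2 ^ x ≈ 2 ^ (x % n)
  2^x≈2^[x%n] x = begin
    2 ^ x                    ≡⟨ cong (2 ^_) (m≡m%n+[m/n]*n x n) ⟩
    2 ^ (x % n + x / n * n)  ≈⟨ 2^[r+q*n]≈2^r (x % n) (x / n) ⟩
    2 ^ (x % n)              ∎
    where
      2^[r+q*n]≈2^r : ∀ r q → 2 ^ (r + q * n) ≈ 2 ^ r
      2^[r+q*n]≈2^r r zero    = ≈-reflexive (cong (2 ^_) (+-identityʳ r))
      2^[r+q*n]≈2^r r (suc q) = begin
        2 ^ (r + (n + q * n))  ≡⟨ cong (2 ^_) (x∙yz≈y∙xz r n (q * n)) ⟩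
        2 ^ (n + (r + q * n))  ≈⟨ 2^[n+x]≈2^x (r + q * n) ⟩
        2 ^ (r + q * n)        ≈⟨ 2^[r+q*n]≈2^r r q ⟩
        2 ^ r                  ∎

  ≈⇒≡-below-2^n : ∀ {x y} → 0 < x → x < 2 ^ n → 0 < y → y < 2 ^ n → x ≈ y → x ≡ y
  ≈⇒≡-below-2^n 0<x x<2^n 0<y y<2^n = ≈⇒≡-pos 0<x (≤M x<2^n) 0<y (≤M y<2^n)
    where ≤M : ∀ {x} → x < 2 ^ n → x ≤ M
          ≤M x<2^n = s≤s⁻¹ (subst (_ <_) 2^n≡1+M x<2^n)

  record ThreeBitForm (x : ℕ) : Set where
    constructor form
    field
      hi mid lo : ℕ
      lo<mid    : lo < mid
      mid<hi    : mid < hi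
      hi<n      : hi < n
      ≈bits₃    : x ≈ bits₃ hi mid lo

  open ThreeBitForm public

  bits₃<2^n : ∀ {x} (F : ThreeBitForm x) → bits₃ (hi F) (mid F) (lo F) < 2 ^ n
  bits₃<2^n F = 2^p+x<2^q (bits₂<2^ (lo<mid F) (mid<hi F)) (hi<n F)

  ThreeBitForm-unique : ∀ {x y} (F : ThreeBitForm x) (G : ThreeBitForm y) → x ≈ y →
                        hi F ≡ hi G × mid F ≡ mid G × lo F ≡ lo G
  ThreeBitForm-unique F G x≈y = bits₃-injective (lo<mid F) (mid<hi F) (lo<mid G) (mid<hi G)
    (≈⇒≡-below-2^n (0<2^p+x (hi F) _) (bits₃<2^n F) (0<2^p+x (hi G) _) (bits₃<2^n G)
      (≈-trans (≈-sym (≈bits₃ F)) (≈-trans x≈y (≈bits₃ G))))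

  ThreeBitForm-≉bits₂ : ∀ {x p q} → ThreeBitForm x → q < p → p < n → ¬ (x ≈ bits₂ p q)
  ThreeBitForm-≉bits₂ {p = p} F q<p p<n x≈bits₂ = bits₃≢bits₂ (lo<mid F) (mid<hi F) q<p
    (≈⇒≡-below-2^n (0<2^p+x (hi F) _) (bits₃<2^n F) (0<2^p+x p _)
      (2^p+x<2^q (2^-monoʳ-< q<p) p<n) (≈-trans (≈-sym (≈bits₃ F)) x≈bits₂))

module Welch (t : ℕ) (2<t : 2 < t) where

  n : ℕ
  n = 2 * t + 1

  instance
    n-nonZero : NonZero n
    n-nonZero = >-nonZero (m≤n+m 1 (2 * t))

  open PowersOfTwo n public

  W : ℕ
  W = welch t

  n≡1+t+t : n ≡ suc (t + t)
  n≡1+t+t = identity t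
    where identity : ∀ t → 2 * t + 1 ≡ suc (t + t)
          identity = solve-∀

  ≤t+t⇒<n : ∀ {x} → x ≤ t + t → x < n
  ≤t+t⇒<n {x} x≤t+t = subst (x <_) (sym n≡1+t+t) (s≤s x≤t+t)

  t<n : t < n
  t<n = ≤t+t⇒<n (m≤m+n t t)

  1<t : 1 < t
  1<t = <-trans (s<s z<s) 2<t

  t-Shaped : ∀ {x} → ThreeBitForm x → Set
  t-Shaped F = (hi F ≡ t ⊎ mid F ≡ t) × lo F ≤ 1

  ShiftForm : ℕ → Set
  ShiftForm a = Σ[ F ∈ ThreeBitForm (W * 2 ^ a) ] ¬ t-Shaped F

  shiftForm-small : ∀ {a} → 0 < a → a ≤ t → ShiftForm a
  shiftForm-small {suc a} _ a≤t =
    form (t + suc a) (suc (suc a)) (suc a) (n<1+n (suc a))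
      (<-trans (n<1+n (suc (suc a))) (+-monoˡ-< (suc a) 2<t))
      (≤t+t⇒<n (+-monoʳ-≤ t a≤t))
      (≈-reflexive (welch*2^a≡bits₃ t (suc a)))
    , λ { (inj₁ t+1+a≡t , _)   → m+1+n≢m t t+1+a≡t
        ; (inj₂ 2+a≡t , 1+a≤1) → <⇒≱ 2<t (subst (_≤ 2) 2+a≡t (s≤s 1+a≤1)) }

  shiftForm-large : ∀ {a} → t < a → suc a < n → ShiftForm a
  shiftForm-large {a} t<a 1+a<n with c , refl ← m≤n⇒∃[o]m+o≡n t<a =
    form (suc a) a c (m<n+m c z<s) (n<1+n a) 1+a<n W*2^a≈bits₃
    , λ { (inj₁ 1+a≡t , _) → >⇒≢ (<-trans t<a (n<1+n a)) 1+a≡t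
        ; (inj₂ a≡t , _)   → >⇒≢ t<a a≡t }
    where
      open import Relation.Binary.Reasoning.Setoid ≈-setoid
      wrap : ∀ t c → t + (suc t + c) ≡ 2 * t + 1 + c
      wrap = solve-∀
      W*2^a≈bits₃ : W * 2 ^ a ≈ bits₃ (suc a) a c
      W*2^a≈bits₃ = begin
        W * 2 ^ a                          ≡⟨ welch*2^a≡bits₃ t a ⟩
        2 ^ (t + a) + bits₂ (suc a) a      ≡⟨ cong (λ x → 2 ^ x + bits₂ (suc a) a) (wrap t c) ⟩
        2 ^ (n + c) + bits₂ (suc a) a      ≈⟨ +-congʳ (bits₂ (suc a) a) (2^[n+x]≈2^x c) ⟩
        2 ^ c + bits₂ (suc a) a            ≡⟨ x∙yz≈y∙zx (2 ^ c) (2 ^ suc a) (2 ^ a) ⟩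
        bits₃ (suc a) a c                  ∎

  shiftForm-top : ∀ {a} → t < a → suc a ≡ n → ShiftForm a
  shiftForm-top {a} t<a 1+a≡n with u , 1+u≡t ← m≤n⇒∃[o]m+o≡n (<-trans z<s 2<t) =
    form a u 0 0<u u<a (subst (a <_) 1+a≡n (n<1+n a)) W*2^a≈bits₃
    , λ { (inj₁ a≡t , _) → >⇒≢ t<a a≡t
        ; (inj₂ u≡t , _) → <⇒≢ u<t u≡t }
    where
      open import Relation.Binary.Reasoning.Setoid ≈-setoid
      u<t : u < t
      u<t = subst (u <_) 1+u≡t (n<1+n u)
      0<u : 0 < u
      0<u = <-trans z<s (s<s⁻¹ (subst (2 <_) (sym 1+u≡t) 2<t))
      u<a : u < a
      u<a = <-trans u<t t<a
      swap : ∀ {p q x y} → suc p ≡ q → suc x ≡ y → q + x ≡ y + p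
      swap {p} {_} {x} refl refl = cong suc (+-comm p x)
      W*2^a≈bits₃ : W * 2 ^ a ≈ bits₃ a u 0
      W*2^a≈bits₃ = begin
        W * 2 ^ a                                ≡⟨ welch*2^a≡bits₃ t a ⟩
        2 ^ (t + a) + (2 ^ suc a + 2 ^ a)        ≡⟨ cong₂ (λ x y → 2 ^ x + (2 ^ y + 2 ^ a)) (swap 1+u≡t 1+a≡n) (swap refl 1+a≡n) ⟩
        2 ^ (n + u) + (2 ^ (n + 0) + 2 ^ a)      ≈⟨ +-cong (2^[n+x]≈2^x u) (+-congʳ (2 ^ a) (2^[n+x]≈2^x 0)) ⟩
        2 ^ u + (2 ^ 0 + 2 ^ a)                  ≡⟨ x∙yz≈z∙xy (2 ^ u) (2 ^ 0) (2 ^ a) ⟩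
        bits₃ a u 0                              ∎

  shiftForm : ∀ {a} → 0 < a → a < n → ShiftForm a
  shiftForm {a} 0<a a<n with ≤-<-connex a t
  ... | inj₁ a≤t = shiftForm-small 0<a a≤t
  ... | inj₂ t<a with m≤n⇒m<n∨m≡n a<n
  ...   | inj₁ 1+a<n = shiftForm-large t<a 1+a<n
  ...   | inj₂ 1+a≡n = shiftForm-top t<a 1+a≡n

  t-Shaped-≈ : ∀ {x y} (F : ThreeBitForm x) (G : ThreeBitForm y) → x ≈ y → t-Shaped G → t-Shaped F
  t-Shaped-≈ F G x≈y (hi∨mid≡t , lo≤1) =
    let hi≡ , mid≡ , lo≡ = ThreeBitForm-unique F G x≈y
    in Sum.map (trans hi≡) (trans mid≡) hi∨mid≡t , subst (_≤ 1) (sym lo≡) lo≤1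

  2^t+2+2^b-t-Shaped : ∀ {b x} → b < n → (F : ThreeBitForm x) → x ≈ 2 ^ t + 2 + 2 ^ b → t-Shaped F
  2^t+2+2^b-t-Shaped {zero} _ F x≈ = t-Shaped-≈ F
    (form t 1 0 z<s 1<t t<n (≈-reflexive (+-assoc (2 ^ t) 2 1))) x≈ (inj₁ refl , z≤n)
  2^t+2+2^b-t-Shaped {suc zero} _ F x≈ = contradiction
    (≈-trans x≈ (≈-reflexive (+-assoc (2 ^ t) 2 2))) (ThreeBitForm-≉bits₂ F 2<t t<n)
  2^t+2+2^b-t-Shaped {b@(suc (suc _))} b<n F x≈ with <-cmp b t
  ... | tri< b<t _ _ = t-Shaped-≈ F
    (form t b 1 (s<s z<s) b<t t<n (≈-reflexive (xy∙z≈x∙zy (2 ^ t) 2 (2 ^ b)))) x≈ (inj₁ refl , ≤-refl)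
  ... | tri≈ _ b≡t _ = contradiction (≈-trans x≈ (≈-reflexive 2^t+2+2^b≡bits₂))
                                      (ThreeBitForm-≉bits₂ F (s<s (<-trans z<s 1<t)) 1+t<n)
    where
      1+t<n : suc t < n
      1+t<n = ≤t+t⇒<n (m<m+n t (<-trans z<s 2<t))
      2^t+2+2^b≡bits₂ : 2 ^ t + 2 + 2 ^ b ≡ bits₂ (suc t) 1
      2^t+2+2^b≡bits₂ = begin
        2 ^ t + 2 + 2 ^ b      ≡⟨ cong (λ x → 2 ^ t + 2 + 2 ^ x) b≡t ⟩
        2 ^ t + 2 + 2 ^ t      ≡⟨ xy∙z≈xz∙y (2 ^ t) 2 (2 ^ t) ⟩
        2 ^ t + 2 ^ t + 2      ≡⟨ cong (λ x → 2 ^ t + x + 2) (+-identityʳ (2 ^ t)) ⟨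
        bits₂ (suc t) 1        ∎
        where open ≡-Reasoning
  ... | tri> _ _ t<b = t-Shaped-≈ F
    (form b t 1 1<t t<b b<n (≈-reflexive (xy∙z≈z∙xy (2 ^ t) 2 (2 ^ b)))) x≈ (inj₂ refl , ≤-refl)

  1<W : 1 < W
  1<W = ≤-trans (m≤n+m 2 (2 ^ t)) (m≤m+n (2 ^ t + 2) 1)

  W*2^a+1≉W+2^b : ∀ {a b} → a < n → b < n → 0 < b → ¬ (W * 2 ^ a + 1 ≈ W + 2 ^ b)
  W*2^a+1≉W+2^b {zero} {b} _ b<n 0<b eq = <⇒≢ (2^-monoʳ-< 0<b)
    (≈⇒≡-below-2^n z<s (2^-monoʳ-< (>-nonZero⁻¹ n)) (m^n>0 2 b) (2^-monoʳ-< b<n)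
      (+-cancelˡ W (≈-trans (≈-reflexive (cong (_+ 1) (sym (*-identityʳ W)))) eq)))
  W*2^a+1≉W+2^b {a@(suc _)} {b} a<n b<n _ eq =
    let F , ¬t-Shaped = shiftForm z<s a<n
    in ¬t-Shaped (2^t+2+2^b-t-Shaped b<n F (+-cancelˡ 1 1+W*2^a≈1+rhs))
    where
      open import Relation.Binary.Reasoning.Setoid ≈-setoid
      regroup : ∀ x y → x + 2 + 1 + y ≡ 1 + (x + 2 + y)
      regroup = solve-∀
      1+W*2^a≈1+rhs : 1 + W * 2 ^ a ≈ 1 + (2 ^ t + 2 + 2 ^ b)
      1+W*2^a≈1+rhs = begin
        1 + W * 2 ^ a             ≡⟨ +-comm 1 (W * 2 ^ a) ⟩
        W * 2 ^ a + 1             ≈⟨ eq ⟩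
        W + 2 ^ b                 ≡⟨ regroup (2 ^ t) (2 ^ b) ⟩
        1 + (2 ^ t + 2 + 2 ^ b)   ∎

  W*2^t<M : W * 2 ^ t < M
  W*2^t<M = s<s⁻¹ (subst (suc (W * P) <_) 2^n≡1+M (begin
    2 + W * P              ≡⟨ expand P ⟩
    P * P + (3 * P + 2)    ≤⟨ +-monoʳ-≤ (P * P) 3P+2≤P*P ⟩
    P * P + P * P          ≡⟨ cong (P * P +_) (+-identityʳ (P * P)) ⟨
    P * P + (P * P + 0)    ≡⟨ cong (λ x → x + (x + 0)) (^-distribˡ-+-* 2 t t) ⟨
    2 ^ suc (t + t)        ≡⟨ cong (2 ^_) n≡1+t+t ⟨
    2 ^ n                  ∎))
    where
      open ≤-Reasoning
      P = 2 ^ t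
      expand : ∀ x → 2 + (x + 2 + 1) * x ≡ x * x + (3 * x + 2)
      expand = solve-∀
      4≤P : 4 ≤ P
      4≤P = ^-monoʳ-≤ 2 {2} (<⇒≤ 2<t)
      3P+2≤P*P : 3 * P + 2 ≤ P * P
      3P+2≤P*P = begin
        3 * P + 2   ≤⟨ +-monoʳ-≤ (3 * P) (≤-trans (s≤s (s≤s z≤n)) 4≤P) ⟩
        3 * P + P   ≡⟨ +-comm (3 * P) P ⟩
        4 * P       ≤⟨ *-monoˡ-≤ P 4≤P ⟩
        P * P       ∎

  W*l≉1 : ∀ {l} → l < n → ¬ (W * l ≈ 1)
  W*l≉1 {l} l<n W*l≈1 = >⇒≢ 1<W (m*n≡1⇒m≡1 W l (≈⇒≡ W*l<M 1<M W*l≈1))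
    where
      W≤W*2^t : W ≤ W * 2 ^ t
      W≤W*2^t = m≤m*n W (2 ^ t) {{m^n≢0 2 t}}
      1<M : 1 < M
      1<M = <-trans (<-≤-trans 1<W W≤W*2^t) W*2^t<M
      l≤2^t : l ≤ 2 ^ t
      l≤2^t = ≤-trans (s≤s⁻¹ (subst (l <_) n≡1+t+t l<n)) (n+n≤2^n t)
      W*l<M : W * l < M
      W*l<M = ≤-<-trans (*-monoʳ-≤ W l≤2^t) W*2^t<M

  W*e≉1 : ∀ {l} k → l < n → ¬ (W * e l k ≈ 1)
  W*e≉1 {l} k l<n W*e≈1 = by-residue (k % n) (m%n<n k n) (2^x≈2^[x%n] k)
    where
      open import Relation.Binary.Reasoning.Setoid ≈-setoid
      by-residue : ∀ b → b < n → 2 ^ k ≈ 2 ^ b → ⊥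
      by-residue zero    _   2^k≈1   = W*l≉1 l<n (≈-trans (*-congˡ W (≈-sym (e≈length 2^k≈1 l))) W*e≈1)
      by-residue (suc b) b<n 2^k≈2^b = W*2^a+1≉W+2^b (m%n<n (l * k) n) b<n z<s (begin
        W * 2 ^ (l * k % n) + 1  ≈⟨ +-congʳ 1 (*-congˡ W (2^x≈2^[x%n] (l * k))) ⟨
        W * 2 ^ (l * k) + 1      ≈⟨ w*e≈1⇒w*2^[l*k]+1≈w+2^k W l k W*e≈1 ⟩
        W + 2 ^ k                ≈⟨ +-congˡ W 2^k≈2^b ⟩
        W + 2 ^ suc b            ∎)

theorem3 : (t : ℕ) → 2 < t →
    (Winv : ℕ) → welch t * Winv ≡ 1 [mod (2 ^ (2 * t + 1) ∸ 1) ] →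
    (l k : ℕ) → l < 2 * t + 1 →
    ¬ (Winv ≡ e l k [mod (2 ^ (2 * t + 1) ∸ 1) ])
theorem3 t 2<t Winv W*Winv≡1 l k l<n Winv≡e =
  W*e≉1 k l<n (≈-trans (*-congˡ W (≈-sym (mk≈ Winv≡e))) (mk≈ W*Winv≡1))
  where open Welch t 2<t
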